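{- Let $n\ge 2$ and $k\ge1$ be integers. Then \[ \gamma_{[k]R}(C_6\Box P_n)\le \left\lceil\frac{4n}{3}\right\rceil(k+1)+\begin{cases}k+1,& n\equiv 0\pmod 3,\\ 0,& n\equiv 1\pmod 3,\\ k,& n\equiv 2\pmod 3.\end{cases} \]
   Context: For a graph $G$ and $v\in V(G)$, $N(v)$ is the open neighborhood and $N[v]=N(v)\cup\{v\}$. For an integer $k\ge1$, a function $f:V(G)\to\{0,1,\dots,k+1\}$ is a $[k]$-Roman dominating function if for every vertex $v$ with $f(v)<k$ we have $\sum_{u\in N[v]}f(u)\ge k+|\{u\in N(v): f(u)>0\}|$. The weight of $f$ is $\sum_{v}f(v)$, and $\gamma_{[k]R}(G)$ is the minimum weight of a $[k]$-Roman dominating function on $G$. $C_m\Box P_n$ is the Cartesian product of the cycle $C_m$ (vertices $0,\dots,m-1$ mod $m$) and the path $P_n$ (vertices $0,\dots,n-1$): $(i,j)\sim(i',j')$ iff ($i=i'$ and $|j-j'|=1$) or ($j=j'$ and $i'\equiv i\pm1 \pmod m$). -}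

module Defs where

open import Data.Nat using (ℕ; zero; suc; _+_; _*_; _≤_; _<_; _/_; _%_)
open import Data.Nat.Properties using (_≟_)
open import Data.Fin using (Fin; toℕ)
open import Data.Fin.Properties using () renaming (_≟_ to _≟F_)
open import Data.List using (List; map; filter; length; allFin; cartesianProduct)
open import Data.Nat.ListAction using (sum)
open import Data.Product using (_×_; _,_; proj₁; proj₂; Σ)
open import Data.Sum using (_⊎_)
open import Relation.Binary.PropositionalEquality using (_≡_)
open import Relation.Nullary using (Dec; ¬_)
open import Relation.Nullary.Decidable using (_⊎-dec_; _×-dec_)
open import Relation.Unary using (Pred; Decidable)

-- Vertices of C_m □ P_n : pairs (i , j) with i ∈ Z_m (cycle), j ∈ {0..n-1} (path).
Vertex : ℕ → ℕ → Set
Vertex m n = Fin m × Fin n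

CycAdj : (m : ℕ) → Fin m → Fin m → Set
CycAdj zero () _
CycAdj (suc m') i i' =
  ((suc (toℕ i)) % (suc m') ≡ toℕ i') ⊎ ((suc (toℕ i')) % (suc m') ≡ toℕ i)

cycAdj? : (m : ℕ) → (i i' : Fin m) → Dec (CycAdj m i i')
cycAdj? zero () _
cycAdj? (suc m') i i' =
  ((suc (toℕ i)) % (suc m') ≟ toℕ i') ⊎-dec ((suc (toℕ i')) % (suc m') ≟ toℕ i)

PathAdj : (n : ℕ) → Fin n → Fin n → Set
PathAdj n j j' = (suc (toℕ j) ≡ toℕ j') ⊎ (suc (toℕ j') ≡ toℕ j)

pathAdj? : (n : ℕ) → (j j' : Fin n) → Dec (PathAdj n j j')
pathAdj? n j j' = (suc (toℕ j) ≟ toℕ j') ⊎-dec (suc (toℕ j') ≟ toℕ j)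

Adj : (m n : ℕ) → Vertex m n → Vertex m n → Set
Adj m n (i , j) (i' , j') = ((i ≡ i') × PathAdj n j j') ⊎ ((j ≡ j') × CycAdj m i i')

adj? : (m n : ℕ) → (u v : Vertex m n) → Dec (Adj m n u v)
adj? m n (i , j) (i' , j') =
  ((i ≟F i') ×-dec pathAdj? n j j') ⊎-dec ((j ≟F j') ×-dec cycAdj? m i i')

vertices : (m n : ℕ) → List (Vertex m n)
vertices m n = cartesianProduct (allFin m) (allFin n)

nbrs : (m n : ℕ) → Vertex m n → List (Vertex m n)
nbrs m n v = filter (adj? m n v) (vertices m n)

IsKRDF : (k m n : ℕ) → (Vertex m n → ℕ) → Set
IsKRDF k m n f =
  (∀ v → f v ≤ suc k) ×
  (∀ v → f v < k →
     k + length (filter (λ u → 1 ≤? f u) (nbrs m n v))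
       ≤ f v + sum (map f (nbrs m n v)))
  where open import Data.Nat using (_≤?_)

weight : (m n : ℕ) → (Vertex m n → ℕ) → ℕ
weight m n f = sum (map f (vertices m n))

-- γ_{[k]R}(C_m □ P_n) ≤ b  :  some [k]RDF has weight ≤ b
-- (γ is the minimum weight, so this is exactly the upper bound)
γkR≤ : (k m n b : ℕ) → Set
γkR≤ k m n b = Σ (Vertex m n → ℕ) λ f → IsKRDF k m n f × weight m n f ≤ b

ceil4n/3 : ℕ → ℕ
ceil4n/3 n = (4 * n + 2) / 3

extra : ℕ → ℕ → ℕ
extra k n with n % 3
... | 0 = suc k
... | 1 = 0
... | _ = k

-- Give every vertex a label: weak, medium or strong, with value 0, k or k + 1. If every
-- weak vertex has a strong neighbour, the values form a [k]-Roman dominating function,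
-- because the strong neighbour contributes k + 1 and each further positive neighbour at
-- least 1. The strong vertices come from a pattern on the strip C₆ × ℕ. It has 2, 1, 1
-- strong vertices in consecutive columns and repeats every three columns, rotated by 3
-- around the cycle. In this pattern every weak vertex of a column y ≥ 1 has a strong
-- neighbour, and when 3 ∣ y one is found without looking at column y + 1. So take the
-- n columns of the strip that end at a column divisible by 3. They start at a column
-- c ∈ {0, 1, 2}. That first column has no left neighbour, so it is patched: by nothing
-- (c = 0), by one extra strong vertex (c = 1), or by one medium vertex (c = 2). The
-- pattern weighs ⌈4n/3⌉(k + 1), and the patch accounts for the correction term.
module Submission where

open import Defs
open import Data.Fin using (Fin; zero; suc; toℕ; fromℕ<; inject₁)
open import Data.Fin.Patterns using (0F; 1F; 2F; 3F; 4F; 5F)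
open import Data.Fin.Properties using (all?; any?; toℕ-fromℕ<; toℕ-inject₁; toℕ<n)
open import Data.List using ([]; _∷_; _++_; map; filter; length; allFin; tabulate; cartesianProduct)
open import Data.List.Membership.Propositional using (_∈_)
open import Data.List.Membership.Propositional.Properties using (∈-filter⁺; ∈-cartesianProduct⁺; ∈-allFin)
open import Data.List.Properties using (map-++; map-tabulate; map-∘; map-cong; filter-accept; filter-reject)
open import Data.List.Relation.Unary.Any using (here; there)
open import Data.Nat using (ℕ; zero; suc; _+_; _*_; _≤_; _<_; z≤n; s≤s; _≤?_; _/_)
open import Data.Nat.Divisibility using (divides)
open import Data.Nat.DivMod using (+-distrib-/-∣ʳ; m*n/n≡m; [m+kn]%n≡m%n)
open import Data.Nat.ListAction using (sum)
open import Data.Nat.ListAction.Properties using (sum-++)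
open import Data.Nat.Properties
open import Data.Nat.Tactic.RingSolver using (solve-∀)
open import Algebra.Properties.CommutativeMonoid.Sum +-0-commutativeMonoid using (∑-comm)
open import Algebra.Properties.CommutativeSemigroup +-commutativeSemigroup using (xy∙z≈xz∙y)
open import Algebra.Properties.Monoid.Sum +-0-monoid using (sum-syntax; sum-cong-≗)
open import Algebra.Properties.Semiring.Sum +-*-semiring using (*-distribʳ-sum)
open import Data.Product using (∃-syntax; _×_; _,_)
open import Data.Sum using (_⊎_; inj₁; inj₂)
open import Function using (_∘_)
open import Relation.Binary.PropositionalEquality
open import Relation.Nullary using (Dec; yes; no; contradiction)
open import Relation.Nullary.Decidable using (_×-dec_; _⊎-dec_; _→-dec_; from-yes)

data Label : Set where
  weak medium strong : Label

value : ℕ → Label → ℕ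
value k weak   = 0
value k medium = k
value k strong = suc k

value≤1+k : ∀ k ℓ → value k ℓ ≤ suc k
value≤1+k k weak   = z≤n
value≤1+k k medium = n≤1+n k
value≤1+k k strong = ≤-refl

value<k⇒weak : ∀ k ℓ → value k ℓ < k → ℓ ≡ weak
value<k⇒weak k weak   _      = refl
value<k⇒weak k medium k<k    = contradiction k<k (n≮n k)
value<k⇒weak k strong 1+k<k = contradiction (<-trans (n<1+n k) 1+k<k) (n≮n k)

weak? : (ℓ : Label) → Dec (ℓ ≡ weak)
weak? weak   = yes refl
weak? medium = no λ ()
weak? strong = no λ ()

strong? : (ℓ : Label) → Dec (ℓ ≡ strong)
strong? weak   = no λ ()
strong? medium = no λ ()
strong? strong = yes refl

module _ {A : Set} (g : A → ℕ) where

  positive? : ∀ x → Dec (1 ≤ g x)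
  positive? x = 1 ≤? g x

  #positive≤sum : ∀ xs → length (filter positive? xs) ≤ sum (map g xs)
  #positive≤sum [] = z≤n
  #positive≤sum (x ∷ xs) with positive? x
  ... | yes 1≤gx rewrite filter-accept positive? {xs = xs} 1≤gx = +-mono-≤ 1≤gx (#positive≤sum xs)
  ... | no 1≰gx rewrite filter-reject positive? {xs = xs} 1≰gx = ≤-trans (#positive≤sum xs) (m≤n+m _ (g x))

  k+#positive≤sum : ∀ k {u} xs → u ∈ xs → suc k ≤ g u → k + length (filter positive? xs) ≤ sum (map g xs)
  k+#positive≤sum k (x ∷ xs) (here refl) 1+k≤gx
    rewrite filter-accept positive? {xs = xs} (≤-trans (s≤s z≤n) 1+k≤gx) | +-suc k (length (filter positive? xs))
    = +-mono-≤ 1+k≤gx (#positive≤sum xs)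
  k+#positive≤sum k (x ∷ xs) (there u∈xs) 1+k≤gu with positive? x
  ... | yes 1≤gx rewrite filter-accept positive? {xs = xs} 1≤gx | +-suc k (length (filter positive? xs))
    = +-mono-≤ 1≤gx (k+#positive≤sum k xs u∈xs 1+k≤gu)
  ... | no 1≰gx rewrite filter-reject positive? {xs = xs} 1≰gx
    = ≤-trans (k+#positive≤sum k xs u∈xs 1+k≤gu) (m≤n+m _ (g x))

StrongNeighbour : ∀ m n → (Vertex m n → Label) → Vertex m n → Set
StrongNeighbour m n L v = ∃[ u ] Adj m n v u × L u ≡ strong

adj⇒∈nbrs : ∀ {m n} {v u : Vertex m n} → Adj m n v u → u ∈ nbrs m n v
adj⇒∈nbrs {m} {n} {v} {i , j} vu = ∈-filter⁺ (adj? m n v) (∈-cartesianProduct⁺ (∈-allFin i) (∈-allFin j)) vu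

isKRDF-if-weak-dominated : ∀ k m n (L : Vertex m n → Label) →
                           (∀ v → L v ≡ weak → StrongNeighbour m n L v) → IsKRDF k m n (value k ∘ L)
isKRDF-if-weak-dominated k m n L dominated = (λ v → value≤1+k k (L v)) , condition
  where
  f = value k ∘ L
  condition : ∀ v → f v < k →
              k + length (filter (λ u → 1 ≤? f u) (nbrs m n v)) ≤ f v + sum (map f (nbrs m n v))
  condition v fv<k with dominated v (value<k⇒weak k (L v) fv<k)
  ... | u , vu , Lu≡strong =
    ≤-trans (k+#positive≤sum f k (nbrs m n v) (adj⇒∈nbrs vu) (≤-reflexive (cong (value k) (sym Lu≡strong))))
            (m≤n+m _ (f v))

sum-tabulate : ∀ n (g : Fin n → ℕ) → sum (tabulate g) ≡ ∑[ j < n ] g j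
sum-tabulate zero    g = refl
sum-tabulate (suc n) g = cong (g zero +_) (sum-tabulate n (g ∘ suc))

sum-map-allFin : ∀ n (g : Fin n → ℕ) → sum (map g (allFin n)) ≡ ∑[ j < n ] g j
sum-map-allFin n g = trans (cong sum (map-tabulate (λ j → j) g)) (sum-tabulate n g)

sum-map-cartesianProduct : ∀ {A B : Set} (f : A × B → ℕ) xs ys →
  sum (map f (cartesianProduct xs ys)) ≡ sum (map (λ x → sum (map (λ y → f (x , y)) ys)) xs)
sum-map-cartesianProduct f [] ys = refl
sum-map-cartesianProduct f (x ∷ xs) ys = begin
  sum (map f (map (x ,_) ys ++ cartesianProduct xs ys))
    ≡⟨ cong sum (map-++ f (map (x ,_) ys) _) ⟩
  sum (map f (map (x ,_) ys) ++ map f (cartesianProduct xs ys))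
    ≡⟨ sum-++ (map f (map (x ,_) ys)) _ ⟩
  sum (map f (map (x ,_) ys)) + sum (map f (cartesianProduct xs ys))
    ≡⟨ cong₂ _+_ (cong sum (sym (map-∘ ys))) (sum-map-cartesianProduct f xs ys) ⟩
  sum (map (λ y → f (x , y)) ys) + sum (map (λ x → sum (map (λ y → f (x , y)) ys)) xs)
    ∎
  where open ≡-Reasoning

weight-by-columns : ∀ m n f → weight m n f ≡ ∑[ j < n ] ∑[ i < m ] f (i , j)
weight-by-columns m n f = begin
  sum (map f (cartesianProduct (allFin m) (allFin n)))
    ≡⟨ sum-map-cartesianProduct f (allFin m) (allFin n) ⟩
  sum (map (λ i → sum (map (λ j → f (i , j)) (allFin n))) (allFin m))
    ≡⟨ cong sum (map-cong (λ i → sum-map-allFin n _) (allFin m)) ⟩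
  sum (map (λ i → ∑[ j < n ] f (i , j)) (allFin m))
    ≡⟨ sum-map-allFin m _ ⟩
  ∑[ i < m ] ∑[ j < n ] f (i , j)
    ≡⟨ ∑-comm (λ i j → f (i , j)) ⟩
  ∑[ j < n ] ∑[ i < m ] f (i , j)
    ∎
  where open ≡-Reasoning

∑-by-threes : ∀ (h : ℕ → ℕ) s → (∀ y → h y + (h (1 + y) + h (2 + y)) ≡ s) →
              ∀ t → ∑[ j < t * 3 ] h (toℕ j) ≡ t * s
∑-by-threes h s triple zero    = refl
∑-by-threes h s triple (suc t) = begin
  h 0 + (h 1 + (h 2 + ∑[ j < t * 3 ] h (3 + toℕ j))) ≡⟨ cong (h 0 +_) (+-assoc (h 1) (h 2) _) ⟨
  h 0 + (h 1 + h 2 + ∑[ j < t * 3 ] h (3 + toℕ j))   ≡⟨ +-assoc (h 0) (h 1 + h 2) _ ⟨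
  h 0 + (h 1 + h 2) + ∑[ j < t * 3 ] h (3 + toℕ j)   ≡⟨ cong₂ _+_ (triple 0) (∑-by-threes (h ∘ (3 +_)) s (triple ∘ (3 +_)) t) ⟩
  s + t * s                                            ∎
  where open ≡-Reasoning

Column : ℕ → Set
Column m = Fin m → Label

-- the missing neighbour of an end column of the path
absent : ∀ {m} → Column m
absent _ = weak

columnLabel : ∀ {m n} → (ℕ → Column m) → Vertex m n → Label
columnLabel col (i , j) = col (toℕ j) i

StrongAround : ∀ {m} → Column m → Fin m → Set
StrongAround {m} col i = ∃[ i' ] CycAdj m i i' × col i' ≡ strong

Covered : ∀ {m} → (left centre right : Column m) → Set
Covered l c r = ∀ i → c i ≡ weak → StrongAround c i ⊎ l i ≡ strong ⊎ r i ≡ strong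

covered? : ∀ {m} (l c r : Column m) → Dec (Covered l c r)
covered? {m} l c r = all? λ i → weak? (c i) →-dec
  (any? (λ i' → cycAdj? m i i' ×-dec strong? (c i')) ⊎-dec (strong? (l i) ⊎-dec strong? (r i)))

module _ {m} (col : ℕ → Column m) where

  strong-around : ∀ {n} i (j : Fin n) → StrongAround (col (toℕ j)) i →
                  StrongNeighbour m n (columnLabel col) (i , j)
  strong-around i j (i' , ii' , strong') = (i' , j) , inj₂ (refl , ii') , strong'

  strong-before : ∀ {n} i (j : Fin n) → col (toℕ j) i ≡ strong →
                  StrongNeighbour m (suc n) (columnLabel col) (i , suc j)
  strong-before i j strong' =
    (i , inject₁ j) , inj₁ (refl , inj₂ (cong suc (toℕ-inject₁ j))) ,
    subst (λ x → col x i ≡ strong) (sym (toℕ-inject₁ j)) strong'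

  strong-after : ∀ {n} i (j : Fin n) (j+1<n : suc (toℕ j) < n) → col (suc (toℕ j)) i ≡ strong →
                 StrongNeighbour m n (columnLabel col) (i , j)
  strong-after i j j+1<n strong' =
    (i , fromℕ< j+1<n) , inj₁ (refl , inj₁ (sym (toℕ-fromℕ< j+1<n))) ,
    subst (λ x → col x i ≡ strong) (sym (toℕ-fromℕ< j+1<n)) strong'

strip : ℕ → Column 6
strip 0 0F = strong
strip 0 2F = strong
strip 1 4F = strong
strip 2 1F = strong
strip 3 3F = strong
strip 3 5F = strong
strip 4 1F = strong
strip 5 4F = strong
strip (suc (suc (suc (suc (suc (suc y)))))) i = strip y i
strip _ _ = weak

strength : ℕ → ℕ
strength 0 = 2
strength 1 = 1
strength 2 = 1
strength (suc (suc (suc y))) = strength y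

strength-triple : ∀ y → strength y + (strength (1 + y) + strength (2 + y)) ≡ 4
strength-triple 0 = refl
strength-triple 1 = refl
strength-triple 2 = refl
strength-triple (suc (suc (suc y))) = strength-triple y

∑-value-strip : ∀ k y → ∑[ i < 6 ] value k (strip y i) ≡ strength y * suc k
∑-value-strip k 0 = refl
∑-value-strip k 1 = refl
∑-value-strip k 2 = refl
∑-value-strip k 3 = refl
∑-value-strip k 4 = refl
∑-value-strip k 5 = refl
∑-value-strip k (suc (suc (suc (suc (suc (suc y)))))) = ∑-value-strip k y

strip-covered : ∀ y → Covered (strip y) (strip (1 + y)) (strip (2 + y))
strip-covered 0 = from-yes (covered? (strip 0) (strip 1) (strip 2))
strip-covered 1 = from-yes (covered? (strip 1) (strip 2) (strip 3))
strip-covered 2 = from-yes (covered? (strip 2) (strip 3) (strip 4))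
strip-covered 3 = from-yes (covered? (strip 3) (strip 4) (strip 5))
strip-covered 4 = from-yes (covered? (strip 4) (strip 5) (strip 6))
strip-covered 5 = from-yes (covered? (strip 5) (strip 6) (strip 7))
strip-covered (suc (suc (suc (suc (suc (suc y)))))) = strip-covered y

strip-covered-last : ∀ t → Covered (strip (2 + t * 3)) (strip (3 + t * 3)) absent
strip-covered-last 0 = from-yes (covered? (strip 2) (strip 3) absent)
strip-covered-last 1 = from-yes (covered? (strip 5) (strip 6) absent)
strip-covered-last (suc (suc t)) = strip-covered-last t

boundary : Fin 3 → Column 6
boundary 1F 1F = strong
boundary 2F 4F = medium
boundary c  i  = strip (toℕ c) i

patchWeight : ℕ → Fin 3 → ℕ
patchWeight k 0F = 0
patchWeight k 1F = suc k
patchWeight k 2F = k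

boundary-covered : ∀ c → Covered absent (boundary c) (strip (1 + toℕ c))
boundary-covered 0F = from-yes (covered? absent (boundary 0F) (strip 1))
boundary-covered 1F = from-yes (covered? absent (boundary 1F) (strip 2))
boundary-covered 2F = from-yes (covered? absent (boundary 2F) (strip 3))

strip-strong⇒boundary-strong : ∀ c i → strip (toℕ c) i ≡ strong → boundary c i ≡ strong
strip-strong⇒boundary-strong 0F i strong' = strong'
strip-strong⇒boundary-strong 1F = from-yes (all? λ i → strong? (strip 1 i) →-dec strong? (boundary 1F i))
strip-strong⇒boundary-strong 2F = from-yes (all? λ i → strong? (strip 2 i) →-dec strong? (boundary 2F i))

∑-value-boundary : ∀ k c → ∑[ i < 6 ] value k (boundary c i) ≡ strength (toℕ c) * suc k + patchWeight k c
∑-value-boundary k 0F = sym (+-identityʳ _)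
∑-value-boundary k 1F = +-comm (suc k) (suc k + 0)
∑-value-boundary k 2F = cong suc (+-comm k (k + 0))

labelling : Fin 3 → ℕ → Column 6
labelling c zero    = boundary c
labelling c (suc x) = strip (suc x + toℕ c)

strip-strong⇒labelling-strong : ∀ c x i → strip (x + toℕ c) i ≡ strong → labelling c x i ≡ strong
strip-strong⇒labelling-strong c zero    = strip-strong⇒boundary-strong c
strip-strong⇒labelling-strong c (suc x) i strong' = strong'

-- The n columns of the strip from column c on; the last of them is column 3 + t * 3.
Window : Fin 3 → ℕ → ℕ → Set
Window c n t = toℕ c + n ≡ 4 + t * 3

window-length≥2 : ∀ c n t → Window c n t → 2 ≤ n
window-length≥2 0F n t refl = s≤s (s≤s z≤n)
window-length≥2 1F n t refl = s≤s (s≤s z≤n)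
window-length≥2 2F n t refl = s≤s (s≤s z≤n)

window-last : ∀ c x t → Window c (2 + x) t → x + toℕ c ≡ 2 + t * 3
window-last c x t c+x+2≡ = suc-injective (suc-injective (trans (+-comm (2 + x) (toℕ c)) c+x+2≡))

window-dominated : ∀ c n t → Window c n t → ∀ v → columnLabel (labelling c) v ≡ weak →
                   StrongNeighbour 6 n (columnLabel (labelling c)) v
window-dominated c n t window (i , zero) weak' with boundary-covered c i weak'
... | inj₁ around       = strong-around (labelling c) i zero around
... | inj₂ (inj₁ ())
... | inj₂ (inj₂ after) = strong-after (labelling c) i zero (window-length≥2 c n t window) after
window-dominated c (suc n) t window (i , suc j) weak' with m≤n⇒m<n∨m≡n (toℕ<n (suc j))
... | inj₁ j+2<n with strip-covered (toℕ j + toℕ c) i weak'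
...   | inj₁ around        = strong-around (labelling c) i (suc j) around
...   | inj₂ (inj₁ before) = strong-before (labelling c) i j (strip-strong⇒labelling-strong c (toℕ j) i before)
...   | inj₂ (inj₂ after)  = strong-after (labelling c) i (suc j) j+2<n after
window-dominated c (suc n) t window (i , suc j) weak' | inj₂ j+2≡n
  with subst (λ y → Covered (strip y) (strip (1 + y)) absent)
             (sym (window-last c (toℕ j) t (trans (cong (toℕ c +_) j+2≡n) window)))
             (strip-covered-last t) i weak'
... | inj₁ around        = strong-around (labelling c) i (suc j) around
... | inj₂ (inj₁ before) = strong-before (labelling c) i j (strip-strong⇒labelling-strong c (toℕ j) i before)
... | inj₂ (inj₂ ())

weight-window : ∀ k c n → weight 6 (suc n) (value k ∘ columnLabel (labelling c)) ≡
                (∑[ j < suc n ] strength (toℕ j + toℕ c)) * suc k + patchWeight k c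
weight-window k c n = begin
  weight 6 (suc n) (value k ∘ columnLabel (labelling c))
    ≡⟨ weight-by-columns 6 (suc n) (value k ∘ columnLabel (labelling c)) ⟩
  ∑[ i < 6 ] value k (boundary c i) + ∑[ j < n ] ∑[ i < 6 ] value k (strip (suc (toℕ j) + toℕ c) i)
    ≡⟨ cong₂ _+_ (∑-value-boundary k c) (sum-cong-≗ {n} (λ j → ∑-value-strip k (suc (toℕ j) + toℕ c))) ⟩
  (strength (toℕ c) * suc k + patchWeight k c) + ∑[ j < n ] (strength (suc (toℕ j) + toℕ c) * suc k)
    ≡⟨ xy∙z≈xz∙y (strength (toℕ c) * suc k) (patchWeight k c) _ ⟩
  ∑[ j < suc n ] (strength (toℕ j + toℕ c) * suc k) + patchWeight k c
    ≡⟨ cong (_+ patchWeight k c) (*-distribʳ-sum {suc n} (suc k) (λ j → strength (toℕ j + toℕ c))) ⟨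
  (∑[ j < suc n ] strength (toℕ j + toℕ c)) * suc k + patchWeight k c
    ∎
  where open ≡-Reasoning

window-construction : ∀ k c n t → Window c n t →
                      γkR≤ k 6 n ((∑[ j < n ] strength (toℕ j + toℕ c)) * suc k + patchWeight k c)
window-construction k c zero    t window = contradiction (window-length≥2 c 0 t window) λ ()
window-construction k c (suc n) t window =
  value k ∘ columnLabel (labelling c) ,
  isKRDF-if-weak-dominated k 6 (suc n) (columnLabel (labelling c)) (window-dominated c (suc n) t window) ,
  ≤-reflexive (weight-window k c n)

ceil4n/3-periodic : ∀ r t → ceil4n/3 (r + t * 3) ≡ ceil4n/3 r + t * 4
ceil4n/3-periodic r t = begin
  (4 * (r + t * 3) + 2) / 3       ≡⟨ cong (_/ 3) (expand r t) ⟩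
  (4 * r + 2 + t * 4 * 3) / 3     ≡⟨ +-distrib-/-∣ʳ (4 * r + 2) (divides (t * 4) refl) ⟩
  (4 * r + 2) / 3 + t * 4 * 3 / 3 ≡⟨ cong ((4 * r + 2) / 3 +_) (m*n/n≡m (t * 4) 3) ⟩
  (4 * r + 2) / 3 + t * 4         ∎
  where
  open ≡-Reasoning
  expand : ∀ r t → 4 * (r + t * 3) + 2 ≡ 4 * r + 2 + t * 4 * 3
  expand = solve-∀

extra-periodic : ∀ k r t → extra k (r + t * 3) ≡ extra k r
extra-periodic k r t rewrite [m+kn]%n≡m%n r t 3 ⦃ _ ⦄ = refl

∑-strength-window : ∀ c n t → Window c n t → ∑[ j < n ] strength (toℕ j + toℕ c) ≡ ceil4n/3 n
∑-strength-window 0F _ t refl =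
  trans (cong (6 +_) (∑-by-threes (λ y → strength (4 + y + 0)) 4 (λ y → strength-triple (4 + y + 0)) t))
        (sym (ceil4n/3-periodic 4 t))
∑-strength-window 1F _ t refl =
  trans (cong (4 +_) (∑-by-threes (λ y → strength (3 + y + 1)) 4 (λ y → strength-triple (3 + y + 1)) t))
        (sym (ceil4n/3-periodic 3 t))
∑-strength-window 2F _ t refl =
  trans (cong (3 +_) (∑-by-threes (λ y → strength (2 + y + 2)) 4 (λ y → strength-triple (2 + y + 2)) t))
        (sym (ceil4n/3-periodic 2 t))

patchWeight≡extra : ∀ k c n t → Window c n t → patchWeight k c ≡ extra k n
patchWeight≡extra k 0F _ t refl = sym (extra-periodic k 4 t)
patchWeight≡extra k 1F _ t refl = sym (extra-periodic k 3 t)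
patchWeight≡extra k 2F _ t refl = sym (extra-periodic k 2 t)

window-exists : ∀ n → 2 ≤ n → ∃[ c ] ∃[ t ] Window c n t
window-exists 1 (s≤s ())
window-exists 2 _ = 2F , 0 , refl
window-exists 3 _ = 1F , 0 , refl
window-exists 4 _ = 0F , 0 , refl
window-exists (suc (suc (suc (suc (suc n))))) _ with window-exists (2 + n) (s≤s (s≤s z≤n))
... | c , t , window = c , suc t , trans (+-comm (toℕ c) (5 + n)) (cong (3 +_) (trans (+-comm (2 + n) (toℕ c)) window))

theorem9 : (n k : ℕ) → 2 ≤ n → 1 ≤ k →
    γkR≤ k 6 n (ceil4n/3 n * suc k + extra k n)
-- The construction needs no assumption on k.
theorem9 n k 2≤n _ with window-exists n 2≤n
... | c , t , window =
  subst (γkR≤ k 6 n)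
        (cong₂ (λ a b → a * suc k + b) (∑-strength-window c n t window) (patchWeight≡extra k c n t window))
        (window-construction k c n t window)
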